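{- Let $n$ be a positive integer. If $(a,b,c)$ is an $n$-powerful triple and $t = t_n(a,b,c) = \frac{a^n - b^n}{c^{n+1}}$, then the triple of positive integers $(x,y,z) = (at, bt, ct)$ is a solution of the diophantine equation $x^n - y^n = z^{n+1}$. Moreover, the map $(a,b,c) \mapsto (a\,t_n(a,b,c),\, b\,t_n(a,b,c),\, c\,t_n(a,b,c))$ restricted to relatively prime $n$-powerful triples is a one-to-one correspondence between relatively prime $n$-powerful triples and positive integral solutions $(x,y,z)$ of $x^n - y^n = z^{n+1}$.
   Context: A triple $(a,b,c)$ of positive integers is called $n$-powerful if $a > b$ and $c^{n+1}$ divides $a^n - b^n$; equivalently, $t_n(a,b,c) = \frac{a^n - b^n}{c^{n+1}}$ is a positive integer. A triple $(a,b,c)$ is relatively prime if $\gcd(a,b,c) = 1$. -}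

module Defs where

open import Data.Nat using (ℕ; zero; suc; _+_; _*_; _∸_; _^_; _<_; NonZero)
open import Data.Nat.Divisibility using (_∣_)
open import Data.Nat.DivMod using (_/_)
open import Data.Nat.Properties using (m^n≢0)
open import Data.Nat.GCD using (gcd)
open import Data.Product using (_×_)
open import Relation.Binary.PropositionalEquality using (_≡_)

Powerful : ℕ → ℕ → ℕ → ℕ → Set
Powerful n a b c = (0 < b) × (b < a) × (0 < c) × (c ^ suc n ∣ a ^ n ∸ b ^ n)

RelPrime : ℕ → ℕ → ℕ → Set
RelPrime a b c = gcd (gcd a b) c ≡ 1

-- t_n(a,b,c) = (a^n - b^n) / c^(n+1); the divisor is taken as c^(n+1) with
-- c = suc c' so that it is nonzero (only used for c > 0).
t : ℕ → ℕ → ℕ → ℕ → ℕ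
t n a b zero = 0
t n a b (suc c) = _/_ (a ^ n ∸ b ^ n) (suc c ^ suc n) {{m^n≢0 (suc c) (suc n)}}

Solution : ℕ → ℕ → ℕ → ℕ → Set
Solution n x y z = (0 < x) × (0 < y) × (0 < z) × (x ^ n ∸ y ^ n ≡ z ^ suc n)

{-# OPTIONS --safe #-}
-- Scaling by k multiplies x^n - y^n by k^n and z^(n+1) by k^(n+1), so an
-- n-powerful triple scaled by t = (a^n - b^n)/c^(n+1) solves the equation.
-- Conversely a solution divided by d = gcd(x,y,z) gives a relatively prime
-- triple with a^n - b^n = d c^(n+1), i.e. an n-powerful triple with t = d.
-- For a relatively prime triple, t is recovered from the image as its gcd,
-- which makes the correspondence injective.
module Submission where

open import Defs
open import Data.Nat using (ℕ; zero; suc; _*_; _∸_; _^_; _<_; NonZero)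
open import Data.Nat.Base using (>-nonZero)
open import Data.Nat.Properties
open import Data.Nat.Divisibility using (divides; ∣-trans)
open import Data.Nat.DivMod using (m/n*n≡m; m*n/n≡m)
open import Data.Nat.GCD using (gcd; c*gcd[m,n]≡gcd[cm,cn]; gcd[m,n]∣m; gcd[m,n]∣n; gcd[m,n]≢0)
open import Data.Nat.Tactic.RingSolver using (solve-∀)
open import Data.Product using (_×_; ∃-syntax; _,_; proj₁; proj₂)
open import Data.Sum using (inj₂)
open import Relation.Binary.PropositionalEquality
open import Relation.Nullary using (contradiction; yes; no)

gcd₃ : ℕ → ℕ → ℕ → ℕ
gcd₃ a b c = gcd (gcd a b) c

gcd₃-*ʳ : ∀ a b c k → gcd₃ (a * k) (b * k) (c * k) ≡ gcd₃ a b c * k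
gcd₃-*ʳ a b c k
  rewrite *-comm a k | *-comm b k | *-comm c k
        | sym (c*gcd[m,n]≡gcd[cm,cn] k a b)
        | sym (c*gcd[m,n]≡gcd[cm,cn] k (gcd a b) c) = *-comm k (gcd₃ a b c)

relPrime-*ʳ : ∀ a b c k → RelPrime a b c → gcd₃ (a * k) (b * k) (c * k) ≡ k
relPrime-*ʳ a b c k coprime = begin
  gcd₃ (a * k) (b * k) (c * k) ≡⟨ gcd₃-*ʳ a b c k ⟩
  gcd₃ a b c * k               ≡⟨ cong (_* k) coprime ⟩
  1 * k                        ≡⟨ *-identityˡ k ⟩
  k                            ∎
  where open ≡-Reasoning

^-distrib-* : ∀ a b n → (a * b) ^ n ≡ a ^ n * b ^ n
^-distrib-* a b zero = refl
^-distrib-* a b (suc n) rewrite ^-distrib-* a b n = interchange a b (a ^ n) (b ^ n)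
  where
  interchange : ∀ a b p q → a * b * (p * q) ≡ a * p * (b * q)
  interchange = solve-∀

^∸^-*ʳ : ∀ n a b k → (a * k) ^ n ∸ (b * k) ^ n ≡ (a ^ n ∸ b ^ n) * k ^ n
^∸^-*ʳ n a b k = begin
  (a * k) ^ n ∸ (b * k) ^ n     ≡⟨ cong₂ _∸_ (^-distrib-* a k n) (^-distrib-* b k n) ⟩
  a ^ n * k ^ n ∸ b ^ n * k ^ n ≡⟨ *-distribʳ-∸ (k ^ n) (a ^ n) (b ^ n) ⟨
  (a ^ n ∸ b ^ n) * k ^ n       ∎
  where open ≡-Reasoning

^-cancelʳ-< : ∀ n {a b} → b ^ n < a ^ n → b < a
^-cancelʳ-< n {a} {b} bⁿ<aⁿ with b <? a
... | yes b<a = b<a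
... | no b≮a  = contradiction (^-monoˡ-≤ n (≮⇒≥ b≮a)) (<⇒≱ bⁿ<aⁿ)

t-spec : ∀ n a b c → Powerful n a b c → a ^ n ∸ b ^ n ≡ t n a b c * c ^ suc n
t-spec n a b (suc c) (_ , _ , _ , cⁿ⁺¹∣) =
  sym (m/n*n≡m {{m^n≢0 (suc c) (suc n)}} cⁿ⁺¹∣)

t-unique : ∀ n a b c k → 0 < c → a ^ n ∸ b ^ n ≡ k * c ^ suc n → t n a b c ≡ k
t-unique n a b (suc c) k _ eq rewrite eq =
  m*n/n≡m k (suc c ^ suc n) {{m^n≢0 (suc c) (suc n)}}

t-pos : ∀ n a b c → 0 < n → Powerful n a b c → 0 < t n a b c
t-pos n a b c 0<n P@(_ , b<a , _ , _) = n≢0⇒n>0 t≢0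
  where
  t≢0 : t n a b c ≢ 0
  t≢0 t≡0 = m>n⇒m∸n≢0 (^-monoˡ-< n {{>-nonZero 0<n}} b<a)
    (trans (t-spec n a b c P) (cong (_* c ^ suc n) t≡0))

scaled-equation : ∀ n a b c k → a ^ n ∸ b ^ n ≡ k * c ^ suc n →
  (a * k) ^ n ∸ (b * k) ^ n ≡ (c * k) ^ suc n
scaled-equation n a b c k eq = begin
  (a * k) ^ n ∸ (b * k) ^ n   ≡⟨ ^∸^-*ʳ n a b k ⟩
  (a ^ n ∸ b ^ n) * k ^ n     ≡⟨ cong (_* k ^ n) eq ⟩
  k * c ^ suc n * k ^ n       ≡⟨ regroup k (c ^ suc n) (k ^ n) ⟩
  c ^ suc n * k ^ suc n       ≡⟨ ^-distrib-* c k (suc n) ⟨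
  (c * k) ^ suc n             ∎
  where
  open ≡-Reasoning
  regroup : ∀ x y z → x * y * z ≡ y * (x * z)
  regroup = solve-∀

scaled-equation⁻¹ : ∀ n a b c k .{{_ : NonZero k}} →
  (a * k) ^ n ∸ (b * k) ^ n ≡ (c * k) ^ suc n → a ^ n ∸ b ^ n ≡ k * c ^ suc n
scaled-equation⁻¹ n a b c k eq = *-cancelʳ-≡ _ _ (k ^ n) {{m^n≢0 k n}} (begin
  (a ^ n ∸ b ^ n) * k ^ n     ≡⟨ ^∸^-*ʳ n a b k ⟨
  (a * k) ^ n ∸ (b * k) ^ n   ≡⟨ eq ⟩
  (c * k) ^ suc n             ≡⟨ ^-distrib-* c k (suc n) ⟩
  c ^ suc n * (k * k ^ n)     ≡⟨ regroup (c ^ suc n) k (k ^ n) ⟩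
  k * c ^ suc n * k ^ n       ∎)
  where
  open ≡-Reasoning
  regroup : ∀ x y z → x * (y * z) ≡ y * x * z
  regroup = solve-∀

powerful-scaling : ∀ n a b c k → 0 < b → 0 < c → 0 < k →
  a ^ n ∸ b ^ n ≡ k * c ^ suc n → Powerful n a b c × t n a b c ≡ k
powerful-scaling n a b c k 0<b 0<c 0<k eq =
  (0<b , b<a , 0<c , divides k eq)
  , t-unique n a b c k 0<c eq
  where
  0<aⁿ∸bⁿ : 0 < a ^ n ∸ b ^ n
  0<aⁿ∸bⁿ = subst (0 <_) (sym eq) (*-mono-< 0<k (m^n>0 c {{>-nonZero 0<c}} (suc n)))
  b<a : b < a
  b<a = ^-cancelʳ-< n (m∸n≢0⇒n<m (n>0⇒n≢0 0<aⁿ∸bⁿ))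

powerful⇒solution : ∀ n a b c → 0 < n → Powerful n a b c →
  Solution n (a * t n a b c) (b * t n a b c) (c * t n a b c)
powerful⇒solution n a b c 0<n P@(0<b , b<a , 0<c , _) =
  *-mono-< (<-trans 0<b b<a) 0<t , *-mono-< 0<b 0<t , *-mono-< 0<c 0<t ,
  scaled-equation n a b c (t n a b c) (t-spec n a b c P)
  where
  0<t : 0 < t n a b c
  0<t = t-pos n a b c 0<n P

image-injective : ∀ n a b c a′ b′ c′ → 0 < n →
  Powerful n a b c → RelPrime a b c →
  Powerful n a′ b′ c′ → RelPrime a′ b′ c′ →
  a * t n a b c ≡ a′ * t n a′ b′ c′ →
  b * t n a b c ≡ b′ * t n a′ b′ c′ →
  c * t n a b c ≡ c′ * t n a′ b′ c′ →
  (a ≡ a′) × (b ≡ b′) × (c ≡ c′)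
image-injective n a b c a′ b′ c′ 0<n P coprime P′ coprime′ a≡ b≡ c≡ =
  cancel a≡ , cancel b≡ , cancel c≡
  where
  T T′ : ℕ
  T = t n a b c
  T′ = t n a′ b′ c′
  T≡T′ : T ≡ T′
  T≡T′ = begin
    T                                  ≡⟨ relPrime-*ʳ a b c T coprime ⟨
    gcd₃ (a * T) (b * T) (c * T)       ≡⟨ cong₂ (λ x y → gcd₃ x y (c * T)) a≡ b≡ ⟩
    gcd₃ (a′ * T′) (b′ * T′) (c * T)   ≡⟨ cong (gcd₃ (a′ * T′) (b′ * T′)) c≡ ⟩
    gcd₃ (a′ * T′) (b′ * T′) (c′ * T′) ≡⟨ relPrime-*ʳ a′ b′ c′ T′ coprime′ ⟩
    T′                                 ∎
    where open ≡-Reasoning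
  cancel : ∀ {u v} → u * T ≡ v * T′ → u ≡ v
  cancel {u} {v} eq = *-cancelʳ-≡ u v T {{>-nonZero (t-pos n a b c 0<n P)}}
    (trans eq (cong (v *_) (sym T≡T′)))

solution⇒powerful : ∀ n x y z → Solution n x y z →
  ∃[ a ] ∃[ b ] ∃[ c ] (Powerful n a b c × RelPrime a b c
    × (a * t n a b c ≡ x) × (b * t n a b c ≡ y) × (c * t n a b c ≡ z))
solution⇒powerful n x y z (_ , 0<y , 0<z , eq)
  with ∣-trans (gcd[m,n]∣m (gcd x y) z) (gcd[m,n]∣m x y)
     | ∣-trans (gcd[m,n]∣m (gcd x y) z) (gcd[m,n]∣n x y)
     | gcd[m,n]∣n (gcd x y) z
... | divides a x≡ | divides b y≡ | divides c z≡ =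
  a , b , c , P , coprime ,
  trans (cong (a *_) t≡d) (sym x≡) ,
  trans (cong (b *_) t≡d) (sym y≡) ,
  trans (cong (c *_) t≡d) (sym z≡)
  where
  d : ℕ
  d = gcd₃ x y z
  0<d : 0 < d
  0<d = n≢0⇒n>0 (gcd[m,n]≢0 (gcd x y) z (inj₂ (n>0⇒n≢0 0<z)))
  instance
    d≢0 : NonZero d
    d≢0 = >-nonZero 0<d
  coprime : RelPrime a b c
  coprime = *-cancelʳ-≡ (gcd₃ a b c) 1 d (begin
    gcd₃ a b c * d               ≡⟨ gcd₃-*ʳ a b c d ⟨
    gcd₃ (a * d) (b * d) (c * d) ≡⟨ cong₂ (λ u v → gcd₃ u v (c * d)) x≡ y≡ ⟨
    gcd₃ x y (c * d)             ≡⟨ cong (gcd₃ x y) z≡ ⟨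
    d                            ≡⟨ *-identityˡ d ⟨
    1 * d                        ∎)
    where open ≡-Reasoning
  aⁿ∸bⁿ≡ : a ^ n ∸ b ^ n ≡ d * c ^ suc n
  aⁿ∸bⁿ≡ = scaled-equation⁻¹ n a b c d
    (subst₂ (λ u v → u ^ n ∸ v ^ n ≡ (c * d) ^ suc n) x≡ y≡
      (subst (λ w → x ^ n ∸ y ^ n ≡ w ^ suc n) z≡ eq))
  powerful×t≡d : Powerful n a b c × t n a b c ≡ d
  powerful×t≡d = powerful-scaling n a b c d
    (*-cancelʳ-< d 0 b (subst (0 <_) y≡ 0<y))
    (*-cancelʳ-< d 0 c (subst (0 <_) z≡ 0<z))
    0<d aⁿ∸bⁿ≡
  P : Powerful n a b c
  P = proj₁ powerful×t≡d
  t≡d : t n a b c ≡ d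
  t≡d = proj₂ powerful×t≡d

theorem1 : (n : ℕ) → 0 < n →
    ((a b c : ℕ) → Powerful n a b c →
      Solution n (a * t n a b c) (b * t n a b c) (c * t n a b c))
    × ((a b c a′ b′ c′ : ℕ) →
      Powerful n a b c → RelPrime a b c →
      Powerful n a′ b′ c′ → RelPrime a′ b′ c′ →
      a * t n a b c ≡ a′ * t n a′ b′ c′ →
      b * t n a b c ≡ b′ * t n a′ b′ c′ →
      c * t n a b c ≡ c′ * t n a′ b′ c′ →
      (a ≡ a′) × (b ≡ b′) × (c ≡ c′))
    × ((x y z : ℕ) → Solution n x y z →
      ∃[ a ] ∃[ b ] ∃[ c ] (Powerful n a b c × RelPrime a b c
        × (a * t n a b c ≡ x) × (b * t n a b c ≡ y) × (c * t n a b c ≡ z)))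
theorem1 n 0<n =
  (λ a b c → powerful⇒solution n a b c 0<n) ,
  (λ a b c a′ b′ c′ → image-injective n a b c a′ b′ c′ 0<n) ,
  solution⇒powerful n
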